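{- Let $n\ge4$, $Q$ an acyclic quiver of type $D_n$, $\underline d\in\Phi_+$ and $\underline e\in\mathbb Z^n$ with $0\le e_k\le d_k$ for all $k$, and let $w$ be the weight function obtained from $M_-$ by performing $e_k$ weighted flips at each tile $k$. Then the numbers $n_{i,j}:=\max(d_i-d_j,0)+(e_j-e_i)$, over all arrows $i\to j$ of $Q$, are all nonnegative if and only if every interior edge of $G$ (an edge shared by two tiles) has nonnegative weight under $w$. In particular, every arrow $i\to j$ is acceptable with respect to $(\underline d,\underline e)$, i.e. $e_i-e_j\le\max(d_i-d_j,0)$, if and only if all interior edges have nonnegative weight.
   Context: $Q$ is an acyclic orientation of the Dynkin diagram $D_n$ with vertices $0,\dots,n-1$ and edges $\{i,i+1\}$ ($0\le i\le n-4$), $\{n-3,n-2\}$, $\{n-3,n-1\}$. $\Phi_+$: positive roots of type $D_n$ in simple-root coordinates (the $0/1$ indicator vectors of nonempty connected vertex sets, together with $e_i+\dots+e_{j-1}+2e_j+\dots+2e_{n-3}+e_{n-2}+e_{n-1}$, $0\le i<j\le n-3$). Base graph $G$: planar bipartite black/white graph, union of tiles $0,\dots,n-1$ (tile $n-3$ a hexagon, others squares); tiles $i,j$ share an edge iff adjacent in the diagram; for every arrow $i\to j$ the shared edge goes black to white when traversing tile $i$ clockwise; tiles $0,\dots,n-3$ form a snake (for $1\le i\le n-4$, tiles $i\pm1$ on opposite edges of tile $i$ if the arrows at $i$ point in opposite directions, adjacent edges if in the same direction); tiles $n-4,n-2,n-1$ glued to three distinct hexagon edges at positions fixed by a convention depending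 on orientation. For a union $H$ of tiles, a boundary edge of $H$ is black-to-white clockwise if it goes from black to white when the boundary of $H$ is traversed clockwise, white-to-black clockwise otherwise. $M_-=M_1\sqcup M_2$ where $M_1$ (resp. $M_2$) is the set of black-to-white clockwise boundary edges of the union of tiles with $d_i\ge1$ (resp. $d_i=2$); initial weight of an edge = its multiplicity in $M_-$. Weighted flip at tile $i$: decrease by $1$ the weight of each black-to-white clockwise edge of tile $i$ and increase by $1$ the weight of each white-to-black clockwise edge of tile $i$. -}

module Defs where

open import Data.Bool using (Bool; true; false; T; _∧_; _∨_; not; if_then_else_)
open import Data.Nat using (ℕ; zero; suc; _≤_; _<_; _∸_; _≡ᵇ_; _<ᵇ_; _≤ᵇ_)
open import Data.Nat.DivMod using (m%n<n; _%_)
open import Data.Fin using (Fin; toℕ; fromℕ<) renaming (zero to fzero; suc to fsuc)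
open import Data.Fin.Properties using () renaming (_≟_ to _≟F_)
open import Data.Integer using (ℤ; +_; _-_; _⊔_) renaming (_+_ to _+ℤ_; _≤_ to _≤ℤ_)
open import Data.List using (List; foldr; allFin)
open import Data.Product using (Σ; _×_; Σ-syntax)
open import Data.Sum using (_⊎_)
open import Data.Empty using (⊥)
open import Relation.Nullary using (¬_)
open import Relation.Nullary.Decidable using (⌊_⌋)
open import Relation.Binary.PropositionalEquality using (_≡_; _≢_)

anyFin : ∀ {m} → (Fin m → Bool) → Bool
anyFin {zero}  f = false
anyFin {suc m} f = f fzero ∨ anyFin (λ k → f (fsuc k))

countFin : ∀ {m} → (Fin m → Bool) → ℕ
countFin {zero}  f = 0
countFin {suc m} f = (if f fzero then 1 else 0) Data.Nat.+ countFin (λ k → f (fsuc k))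

iter : ∀ {A : Set} → ℕ → (A → A) → A → A
iter zero    f x = x
iter (suc k) f x = f (iter k f x)

next : ∀ {m} → Fin (suc m) → Fin (suc m)
next {m} p = fromℕ< (m%n<n (suc (toℕ p)) (suc m))

ind : Bool → ℤ
ind true  = + 1
ind false = + 0

-- The Dynkin diagram D_n, vertices 0..n-1 (n ≥ 4):
-- edges {i,i+1} (0 ≤ i ≤ n-4), {n-3,n-2}, {n-3,n-1}.

DEdge : (n : ℕ) → Fin n → Fin n → Set
DEdge n i j =
  (suc (toℕ i) ≡ toℕ j × toℕ j ≤ n ∸ 3)
  ⊎ (toℕ i ≡ n ∸ 3 × toℕ j ≡ n ∸ 2)
  ⊎ (toℕ i ≡ n ∸ 3 × toℕ j ≡ n ∸ 1)

Adjacent : (n : ℕ) → Fin n → Fin n → Set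
Adjacent n i j = DEdge n i j ⊎ DEdge n j i

-- An orientation Q of D_n (automatically acyclic, D_n being a tree).
record Orientation (n : ℕ) : Set where
  field
    arr      : Fin n → Fin n → Bool
    arr-adj  : ∀ i j → T (arr i j) → Adjacent n i j
    arr-tot  : ∀ i j → Adjacent n i j → T (arr i j) ⊎ T (arr j i)
    arr-asym : ∀ i j → T (arr i j) → T (arr j i) → ⊥

Arrow : ∀ {n} → Orientation n → Fin n → Fin n → Set
Arrow Q i j = T (Orientation.arr Q i j)

-- Positive roots of D_n (simple-root coordinates)

data Reach {n : ℕ} (S : Fin n → Bool) : Fin n → Fin n → Set where
  here : ∀ {x} → Reach S x x
  step : ∀ {x y z} → Adjacent n x y → T (S y) → Reach S y z → Reach S x z

ConnectedNonempty : (n : ℕ) → (Fin n → Bool) → Set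
ConnectedNonempty n S =
  (Σ[ k ∈ Fin n ] T (S k)) ×
  (∀ x y → T (S x) → T (S y) → Reach S x y)

-- e_i+…+e_{j-1}+2e_j+…+2e_{n-3}+e_{n-2}+e_{n-1}, value at coordinate k
rootVal : (n i j k : ℕ) → ℕ
rootVal n i j k =
  if k <ᵇ i then 0 else
  if k <ᵇ j then 1 else
  if k ≤ᵇ n ∸ 3 then 2 else 1

PosRoot : (n : ℕ) → (Fin n → ℕ) → Set
PosRoot n d =
  (Σ[ S ∈ (Fin n → Bool) ] ConnectedNonempty n S ×
     (∀ k → d k ≡ (if S k then 1 else 0)))
  ⊎ (Σ[ i ∈ ℕ ] Σ[ j ∈ ℕ ] i < j × j ≤ n ∸ 3 ×
     (∀ k → d k ≡ rootVal n i j (toℕ k)))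

tileSize : (n : ℕ) → Fin n → ℕ
tileSize n k = suc (if toℕ k ≡ᵇ n ∸ 3 then 5 else 3)

record BaseGraph (n : ℕ) (Q : Orientation n) : Set₁ where
  field
    V     : ℕ
    black : Fin V → Bool
    -- boundary cycle of tile k listed in clockwise order
    cyc   : (k : Fin n) → Fin (tileSize n k) → Fin V

  SharesAt : (i : Fin n) → Fin (tileSize n i) → Fin n → Set
  SharesAt i p j = Σ[ q ∈ Fin (tileSize n j) ]
    ((cyc j q ≡ cyc i p × cyc j (next q) ≡ cyc i (next p))
     ⊎ (cyc j q ≡ cyc i (next p) × cyc j (next q) ≡ cyc i p))

  field
    cyc-simple : ∀ k p q → cyc k p ≡ cyc k q → p ≡ q
    bipartite  : ∀ k p → ¬ (black (cyc k p) ≡ black (cyc k (next p)))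
    covers     : ∀ v → Σ[ k ∈ Fin n ] Σ[ p ∈ Fin (tileSize n k) ] cyc k p ≡ v
    -- planarity: an edge lies on at most two tiles ...
    atMostTwo  : ∀ i p j k → i ≢ j → i ≢ k → j ≢ k →
                 SharesAt i p j → SharesAt i p k → ⊥
    -- ... and two distinct faces traverse a common edge in opposite directions
    oppositeDir : ∀ i p j q → i ≢ j →
                 cyc j q ≡ cyc i p → cyc j (next q) ≡ cyc i (next p) → ⊥
    share→adj  : ∀ i j → i ≢ j → (Σ[ p ∈ Fin (tileSize n i) ] SharesAt i p j) → Adjacent n i j
    adj→share  : ∀ i j → Adjacent n i j → Σ[ p ∈ Fin (tileSize n i) ] SharesAt i p j
    arrowBW    : ∀ i j → Arrow Q i j → ∀ p → SharesAt i p j → black (cyc i p) ≡ true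
    snake      : ∀ h i j → suc (toℕ h) ≡ toℕ i → suc (toℕ i) ≡ toℕ j → toℕ j ≤ n ∸ 3 →
                 ∀ p q → SharesAt i p h → SharesAt i q j →
                 (((Arrow Q h i × Arrow Q i j) ⊎ (Arrow Q j i × Arrow Q i h)) →
                    (toℕ q ≡ (toℕ p Data.Nat.+ 1) % tileSize n i
                     ⊎ toℕ p ≡ (toℕ q Data.Nat.+ 1) % tileSize n i))
                 × (((Arrow Q h i × Arrow Q j i) ⊎ (Arrow Q i h × Arrow Q i j)) →
                    toℕ q ≡ (toℕ p Data.Nat.+ 2) % tileSize n i)

  -- Edges are keyed by (b , w) with b black and w white.

  trav : Fin n → Fin V → Fin V → Bool
  trav k x y = anyFin (λ p → ⌊ cyc k p ≟F x ⌋ ∧ ⌊ cyc k (next p) ≟F y ⌋)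

  isBW : Fin V → Fin V → Bool
  isBW b w = black b ∧ not (black w)

  inTile : Fin n → Fin V → Fin V → Bool
  inTile k b w = isBW b w ∧ (trav k b w ∨ trav k w b)

  bwIn : Fin n → Fin V → Fin V → Bool
  bwIn k b w = isBW b w ∧ trav k b w

  wbIn : Fin n → Fin V → Fin V → Bool
  wbIn k b w = isBW b w ∧ trav k w b

  -- (b,w) is a black-to-white clockwise boundary edge of the union H of tiles:
  -- it lies on exactly one tile of H, and that tile traverses it b → w.
  bdryBW : (Fin n → Bool) → Fin V → Fin V → Bool
  bdryBW H b w = (countFin (λ k → H k ∧ inTile k b w) ≡ᵇ 1)
               ∧ (countFin (λ k → H k ∧ bwIn k b w) ≡ᵇ 1)

  Weight : Set
  Weight = Fin V → Fin V → ℤ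

  -- initial weight: multiplicity in M₋ = M₁ ⊔ M₂
  initWeight : (Fin n → ℕ) → Weight
  initWeight d b w = ind (bdryBW (λ k → 1 ≤ᵇ d k) b w) +ℤ ind (bdryBW (λ k → d k ≡ᵇ 2) b w)

  flip : Fin n → Weight → Weight
  flip k W b w = (W b w - ind (bwIn k b w)) +ℤ ind (wbIn k b w)

  weight : (Fin n → ℕ) → (Fin n → ℕ) → Weight
  weight d e = foldr (λ k W → iter (e k) (flip k) W) (initWeight d) (allFin n)

  Interior : Fin V → Fin V → Set
  Interior b w = Σ[ i ∈ Fin n ] Σ[ j ∈ Fin n ] i ≢ j × T (inTile i b w) × T (inTile j b w)

nIJ : ∀ {n} → (Fin n → ℕ) → (Fin n → ℕ) → Fin n → Fin n → ℤ
nIJ d e i j = ((+ d i - + d j) ⊔ + 0) +ℤ (+ e j - + e i)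

Acceptable : ∀ {n} → (Fin n → ℕ) → (Fin n → ℕ) → Fin n → Fin n → Set
Acceptable d e i j = (+ e i - + e j) ≤ℤ ((+ d i - + d j) ⊔ + 0)

-- For an interior edge (b , w) shared by the tiles i and j, with i traversing it from b to w,
-- every flip at i lowers its weight by one, every flip at j raises it by one and no other flip
-- touches it, so w(b , w) = w₀(b , w) + e_j − e_i. Initially (b , w) is a black-to-white boundary
-- edge of the union of tiles with d ≥ t exactly when d_i ≥ t > d_j; as d ≤ 2 for a positive root,
-- counting the levels t = 1, 2 gives w₀(b , w) = max(d_i − d_j , 0). The colouring convention
-- makes i → j the arrow between the two tiles, so w(b , w) = n_{i,j}, and every arrow arises from
-- exactly such an edge. No bound on e is needed.
module Submission where

open import Defs
open import Data.Nat using (ℕ; _≤_)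
open import Data.Fin using (Fin)
open import Data.Integer using (+_) renaming (_≤_ to _≤ℤ_)
open import Data.Product using (_×_)
open import Function.Bundles using (_⇔_)

open import Algebra.Bundles using (CommutativeMonoid)
open import Data.Bool using (Bool; true; false; T; _∧_; _∨_; not; if_then_else_)
open import Data.Bool.Properties using (T-≡; T-∧; T-∨; ∧-identityʳ; ∧-zeroʳ; ∨-zeroʳ; ¬-not)
open import Data.Empty using (⊥; ⊥-elim)
open import Data.Fin using (zero; suc; toℕ)
import Data.Fin.Properties as Fin
open import Data.Integer using (ℤ; -_; _-_; _⊔_; 0ℤ; 1ℤ) renaming (_+_ to _+ℤ_; _*_ to _*ℤ_)
import Data.Integer.Properties as ℤ
open import Data.Integer.Tactic.RingSolver using (solve-∀)
open import Data.List using (foldr; tabulate)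
open import Data.Nat using (zero; suc; z≤n; s≤s; _<_; _∸_; _≡ᵇ_; _<ᵇ_; _≤ᵇ_) renaming (_+_ to _+ℕ_)
open import Data.Nat.DivMod using (_%_; m<n⇒m%n≡m; n%n≡0)
import Data.Nat.Properties as ℕ
open import Data.Product using (∃; ∃₂; _,_; proj₁)
open import Data.Sum using (_⊎_; inj₁; inj₂)
open import Data.Unit using (tt)
open import Data.Vec.Functional using (Vector; tail)
open import Function.Base using (_∘_; id; case_of_)
open import Function.Bundles using (mk⇔; Equivalence)
open import Relation.Binary.PropositionalEquality
open import Relation.Nullary using (¬_; yes; no; contradiction)
open import Relation.Nullary.Decidable using (⌊_⌋; toWitness; fromWitness)

open import Function.Properties.Equivalence using () renaming (trans to ⇔-trans)

open Equivalence using (to; from)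

¬T⇒≡false : ∀ {x} → ¬ T x → x ≡ false
¬T⇒≡false {false} _  = refl
¬T⇒≡false {true}  ¬t = ⊥-elim (¬t tt)

module FinSum {c ℓ} (M : CommutativeMonoid c ℓ) where
  open CommutativeMonoid M
    using (Carrier; _≈_; ∙-congˡ; ∙-congʳ; identityˡ; identityʳ; comm)
    renaming (_∙_ to _+_; ε to 0#; trans to ≈-trans)
  open import Algebra.Properties.CommutativeMonoid.Sum M using (sum-cong-≋; sum-replicate-zero)
  open import Algebra.Properties.CommutativeMonoid.Sum M public using (sum; sum-syntax)

  sum-zero : ∀ {m} (t : Vector Carrier m) → (∀ k → t k ≈ 0#) → sum t ≈ 0#
  sum-zero {m} t t≈0 = ≈-trans (sum-cong-≋ t≈0) (sum-replicate-zero m)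

  sum-single : ∀ {m} (t : Vector Carrier m) i → (∀ k → k ≢ i → t k ≈ 0#) → sum t ≈ t i
  sum-single t zero t≈0 =
    ≈-trans (∙-congˡ (sum-zero (tail t) (λ k → t≈0 (suc k) λ ()))) (identityʳ _)
  sum-single t (suc i) t≈0 =
    ≈-trans (∙-congʳ (t≈0 zero λ ()))
      (≈-trans (identityˡ _) (sum-single (tail t) i (λ k k≢i → t≈0 (suc k) (k≢i ∘ Fin.suc-injective))))

  sum-pair : ∀ {m} (t : Vector Carrier m) {i j} → i ≢ j →
             (∀ k → k ≢ i → k ≢ j → t k ≈ 0#) → sum t ≈ t i + t j
  sum-pair t {zero}  {zero}  i≢j _   = contradiction refl i≢j
  sum-pair t {zero}  {suc j} _   t≈0 =
    ∙-congˡ (sum-single (tail t) j (λ k k≢j → t≈0 (suc k) (λ ()) (k≢j ∘ Fin.suc-injective)))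
  sum-pair t {suc i} {zero}  _   t≈0 =
    ≈-trans (∙-congˡ (sum-single (tail t) i (λ k k≢i → t≈0 (suc k) (k≢i ∘ Fin.suc-injective) (λ ()))))
          (comm _ _)
  sum-pair t {suc i} {suc j} i≢j t≈0 =
    ≈-trans (∙-congʳ (t≈0 zero (λ ()) (λ ())))
      (≈-trans (identityˡ _)
        (sum-pair (tail t) (i≢j ∘ cong suc)
          (λ k k≢i k≢j → t≈0 (suc k) (k≢i ∘ Fin.suc-injective) (k≢j ∘ Fin.suc-injective))))

module ℕΣ = FinSum ℕ.+-0-commutativeMonoid
module ℤΣ = FinSum ℤ.+-0-commutativeMonoid
open ℤΣ using (sum-syntax)

indℕ : Bool → ℕ
indℕ b = if b then 1 else 0

countFin≡sum : ∀ {m} (f : Fin m → Bool) → countFin f ≡ ℕΣ.sum (indℕ ∘ f)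
countFin≡sum {zero}  f = refl
countFin≡sum {suc m} f = cong (indℕ (f zero) +ℕ_) (countFin≡sum (f ∘ suc))

countFin-single : ∀ {m} (f : Fin m → Bool) i → (∀ k → k ≢ i → f k ≡ false) →
                  countFin f ≡ indℕ (f i)
countFin-single f i off = trans (countFin≡sum f) (ℕΣ.sum-single (indℕ ∘ f) i (λ k → cong indℕ ∘ off k))

countFin-pair : ∀ {m} (f : Fin m → Bool) {i j} → i ≢ j → (∀ k → k ≢ i → k ≢ j → f k ≡ false) →
                countFin f ≡ indℕ (f i) +ℕ indℕ (f j)
countFin-pair f i≢j off =
  trans (countFin≡sum f) (ℕΣ.sum-pair (indℕ ∘ f) i≢j (λ k k≢i → cong indℕ ∘ off k k≢i))

anyFin⁺ : ∀ {m} (f : Fin m → Bool) {p} → T (f p) → T (anyFin f)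
anyFin⁺ f {zero}  t = from T-∨ (inj₁ t)
anyFin⁺ f {suc p} t = from (T-∨ {f zero}) (inj₂ (anyFin⁺ (f ∘ suc) t))

anyFin⁻ : ∀ {m} (f : Fin m → Bool) → T (anyFin f) → ∃ λ p → T (f p)
anyFin⁻ {suc m} f t with to (T-∨ {f zero}) t
... | inj₁ t₀ = zero , t₀
... | inj₂ t₊ with anyFin⁻ (f ∘ suc) t₊
...   | p , tₚ = suc p , tₚ

toℕ-next : ∀ {m} (p : Fin (suc m)) → toℕ (next p) ≡ suc (toℕ p) % suc m
toℕ-next p = Fin.toℕ-fromℕ< _

next∘next≢id : ∀ {m} → 2 ≤ m → (p : Fin (suc m)) → next (next p) ≢ p
next∘next≢id {m} 2≤m p eq =
  no-2-cycle (Fin.toℕ≤pred[n] p)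
    (trans (sym (trans (toℕ-next (next p)) (cong succ (toℕ-next p)))) (cong toℕ eq))
  where
  succ : ℕ → ℕ
  succ x = suc x % suc m

  succ-< : ∀ {x} → x < m → succ x ≡ suc x
  succ-< x<m = m<n⇒m%n≡m (s≤s x<m)

  succ-m : ∀ {x} → x ≡ m → succ x ≡ 0
  succ-m refl = n%n≡0 (suc m)

  no-2-cycle : ∀ {x} → x ≤ m → succ (succ x) ≢ x
  no-2-cycle {x} x≤m loop with ℕ.m≤n⇒m<n∨m≡n x≤m
  ... | inj₂ x≡m = ℕ.<⇒≢ 2≤m (sym (trans (sym x≡m) (trans (sym loop) succ²≡1)))
    where
    succ²≡1 : succ (succ x) ≡ 1
    succ²≡1 = trans (cong succ (succ-m x≡m)) (succ-< (ℕ.≤-trans (s≤s z≤n) 2≤m))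
  ... | inj₁ x<m with ℕ.m≤n⇒m<n∨m≡n x<m
  ...   | inj₁ 1+x<m = ℕ.<⇒≢ (ℕ.m<n⇒m<1+n (ℕ.n<1+n x))
                         (sym (trans (sym (trans (cong succ (succ-< x<m)) (succ-< 1+x<m))) loop))
  ...   | inj₂ 1+x≡m = ℕ.<⇒≢ 2≤m (sym (trans (sym 1+x≡m) (cong suc x≡0)))
    where
    x≡0 : x ≡ 0
    x≡0 = trans (sym loop) (trans (cong succ (succ-< x<m)) (succ-m 1+x≡m))

posRoot-≤2 : ∀ {n} {d : Fin n → ℕ} → PosRoot n d → ∀ k → d k ≤ 2
posRoot-≤2 (inj₁ (S , _ , d≡)) k = subst (_≤ 2) (sym (d≡ k)) (indicator≤2 (S k))
  where
  indicator≤2 : ∀ b → (if b then 1 else 0) ≤ 2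
  indicator≤2 true  = s≤s z≤n
  indicator≤2 false = z≤n
posRoot-≤2 {n} (inj₂ (i , j , _ , _ , d≡)) k =
  subst (_≤ 2) (sym (d≡ k)) (rootVal≤2 (toℕ k <ᵇ i) (toℕ k <ᵇ j) (toℕ k ≤ᵇ n ∸ 3))
  where
  rootVal≤2 : ∀ a b c → (if a then 0 else if b then 1 else if c then 2 else 1) ≤ 2
  rootVal≤2 true  _     _     = z≤n
  rootVal≤2 false true  _     = s≤s z≤n
  rootVal≤2 false false true  = ℕ.≤-refl
  rootVal≤2 false false false = s≤s z≤n

-- The two summands count the levels t ∈ {1, 2} with x ≥ t > y.
levels≡positivePart : ∀ {x y} → x ≤ 2 → y ≤ 2 →
  ind ((1 ≤ᵇ x) ∧ not (1 ≤ᵇ y)) +ℤ ind ((x ≡ᵇ 2) ∧ not (y ≡ᵇ 2)) ≡ (+ x - + y) ⊔ + 0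
levels≡positivePart {0} {0} _ _ = refl
levels≡positivePart {0} {1} _ _ = refl
levels≡positivePart {0} {2} _ _ = refl
levels≡positivePart {1} {0} _ _ = refl
levels≡positivePart {1} {1} _ _ = refl
levels≡positivePart {1} {2} _ _ = refl
levels≡positivePart {2} {0} _ _ = refl
levels≡positivePart {2} {1} _ _ = refl
levels≡positivePart {2} {2} _ _ = refl
levels≡positivePart {suc (suc (suc _))} (s≤s (s≤s ())) _
levels≡positivePart {_} {suc (suc (suc _))} _ (s≤s (s≤s ()))

exactlyOne∧first≡first∧¬second : ∀ x y → ((indℕ x +ℕ indℕ y) ≡ᵇ 1) ∧ (indℕ x ≡ᵇ 1) ≡ x ∧ not y
exactlyOne∧first≡first∧¬second true  true  = refl
exactlyOne∧first≡first∧¬second true  false = refl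
exactlyOne∧first≡first∧¬second false true  = refl
exactlyOne∧first≡first∧¬second false false = refl

Acceptable⇔0≤nIJ : ∀ {n} (d e : Fin n → ℕ) i j → Acceptable d e i j ⇔ (+ 0 ≤ℤ nIJ d e i j)
Acceptable⇔0≤nIJ d e i j = mk⇔
  (λ acc → subst (+ 0 ≤ℤ_) (sym (rearrange M (+ e i) (+ e j))) (ℤ.i≤j⇒0≤j-i acc))
  (λ 0≤n → ℤ.0≤i-j⇒j≤i (subst (+ 0 ≤ℤ_) (rearrange M (+ e i) (+ e j)) 0≤n))
  where
  M : ℤ
  M = (+ d i - + d j) ⊔ + 0
  rearrange : ∀ m x y → m +ℤ (y - x) ≡ m - (x - y)
  rearrange = solve-∀

∧-not≡true⇒≡false : ∀ {x y} → x ∧ not y ≡ true → y ≡ false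
∧-not≡true⇒≡false {true} {false} _ = refl
∧-not≡true⇒≡false {true} {true}  ()
∧-not≡true⇒≡false {false}        ()

module TileGraph {n} {Q : Orientation n} (G : BaseGraph n Q) where
  open BaseGraph G
  open Orientation Q

  δ : Fin n → Fin V → Fin V → ℤ
  δ k b w = ind (wbIn k b w) - ind (bwIn k b w)

  iter-flip : ∀ m k (W : Weight) b w → iter m (flip k) W b w ≡ W b w +ℤ + m *ℤ δ k b w
  iter-flip zero    k W b w = sym (trans (cong (W b w +ℤ_) (ℤ.*-zeroˡ (δ k b w))) (ℤ.+-identityʳ _))
  iter-flip (suc m) k W b w =
    trans (cong (λ v → (v - ind (bwIn k b w)) +ℤ ind (wbIn k b w)) (iter-flip m k W b w))
          (one-more-flip (W b w) (+ m) (ind (bwIn k b w)) (ind (wbIn k b w)))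
    where
    one-more-flip : ∀ a m x y → ((a +ℤ m *ℤ (y - x)) - x) +ℤ y ≡ a +ℤ (+ 1 +ℤ m) *ℤ (y - x)
    one-more-flip = solve-∀

  foldr-flips : ∀ (e : Fin n → ℕ) {m} (f : Fin m → Fin n) (W : Weight) b w →
    foldr (λ k W → iter (e k) (flip k) W) W (tabulate f) b w
      ≡ W b w +ℤ ∑[ k < m ] (+ e (f k) *ℤ δ (f k) b w)
  foldr-flips e {zero}  f W b w = sym (ℤ.+-identityʳ _)
  foldr-flips e {suc m} f W b w = begin
    iter (e (f zero)) (flip (f zero)) W′ b w  ≡⟨ iter-flip (e (f zero)) (f zero) W′ b w ⟩
    W′ b w +ℤ t₀                              ≡⟨ cong (_+ℤ t₀) (foldr-flips e (f ∘ suc) W b w) ⟩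
    (W b w +ℤ ∑₊) +ℤ t₀                       ≡⟨ ℤ.+-assoc (W b w) ∑₊ t₀ ⟩
    W b w +ℤ (∑₊ +ℤ t₀)                       ≡⟨ cong (W b w +ℤ_) (ℤ.+-comm ∑₊ t₀) ⟩
    W b w +ℤ (t₀ +ℤ ∑₊)                       ∎
    where
    open ≡-Reasoning
    W′ : Weight
    W′ = foldr (λ k W → iter (e k) (flip k) W) W (tabulate (f ∘ suc))
    t₀ ∑₊ : ℤ
    t₀ = + e (f zero) *ℤ δ (f zero) b w
    ∑₊ = ∑[ k < m ] (+ e (f (suc k)) *ℤ δ (f (suc k)) b w)

  weight≡init+∑ : ∀ d e b w → weight d e b w ≡ initWeight d b w +ℤ ∑[ k < n ] (+ e k *ℤ δ k b w)
  weight≡init+∑ d e = foldr-flips e id (initWeight d)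

  Traverses : Fin n → Fin V → Fin V → Set
  Traverses k x y = ∃ λ p → cyc k p ≡ x × cyc k (next p) ≡ y

  private
    matches : (k : Fin n) → Fin V → Fin V → Fin (tileSize n k) → Bool
    matches k x y r = ⌊ cyc k r Fin.≟ x ⌋ ∧ ⌊ cyc k (next r) Fin.≟ y ⌋

    matches⇔ : ∀ {k x y} r → T (matches k x y r) ⇔ (cyc k r ≡ x × cyc k (next r) ≡ y)
    matches⇔ {k} {x} {y} r = mk⇔
      (λ t → let t₀ , t₁ = to (T-∧ {⌊ cyc k r Fin.≟ x ⌋}) t in toWitness t₀ , toWitness t₁)
      (λ (r₀ , r₁) → from (T-∧ {⌊ cyc k r Fin.≟ x ⌋}) (fromWitness r₀ , fromWitness r₁))

  trav⁺ : ∀ {k x y} → Traverses k x y → trav k x y ≡ true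
  trav⁺ {k} {x} {y} (p , eqs) = to T-≡ (anyFin⁺ (matches k x y) {p} (from (matches⇔ p) eqs))

  trav⁻ : ∀ {k x y} → T (trav k x y) → Traverses k x y
  trav⁻ {k} {x} {y} t = let p , tₚ = anyFin⁻ (matches k x y) t in p , to (matches⇔ p) tₚ

  ¬traverses-both-ways : ∀ {k x y} → Traverses k x y → Traverses k y x → ⊥
  ¬traverses-both-ways {k} (p , p₀ , p₁) (q , q₀ , q₁) =
    next∘next≢id (sides k) p (trans (cong next (sym q≡next-p)) next-q≡p)
    where
    sides : ∀ t → 2 ≤ (if toℕ t ≡ᵇ n ∸ 3 then 5 else 3)
    sides t with toℕ t ≡ᵇ n ∸ 3
    ... | true  = s≤s (s≤s z≤n)
    ... | false = s≤s (s≤s z≤n)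
    q≡next-p : q ≡ next p
    q≡next-p = cyc-simple k q (next p) (trans q₀ (sym p₁))
    next-q≡p : next q ≡ p
    next-q≡p = cyc-simple k (next q) p (trans q₁ (sym p₀))

  ¬traverses-same-way : ∀ {i j x y} → i ≢ j → Traverses i x y → Traverses j x y → ⊥
  ¬traverses-same-way {i} {j} i≢j (p , p₀ , p₁) (q , q₀ , q₁) =
    oppositeDir i p j q i≢j (trans q₀ (sym p₀)) (trans q₁ (sym p₁))

  sharesAt : ∀ {i k x y} (tᵢ : Traverses i x y) → Traverses k x y ⊎ Traverses k y x →
             SharesAt i (proj₁ tᵢ) k
  sharesAt (p , p₀ , p₁) (inj₁ (q , q₀ , q₁)) = q , inj₁ (trans q₀ (sym p₀) , trans q₁ (sym p₁))
  sharesAt (p , p₀ , p₁) (inj₂ (q , q₀ , q₁)) = q , inj₂ (trans q₀ (sym p₁) , trans q₁ (sym p₀))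

  on-at-most-two : ∀ {i j k x y} → i ≢ j → Traverses i x y → Traverses j y x →
                   Traverses k x y ⊎ Traverses k y x → k ≡ i ⊎ k ≡ j
  on-at-most-two {i} {j} {k} i≢j tᵢ tⱼ tₖ with k Fin.≟ i | k Fin.≟ j
  ... | yes k≡i | _       = inj₁ k≡i
  ... | no _    | yes k≡j = inj₂ k≡j
  ... | no k≢i  | no k≢j  =
    ⊥-elim (atMostTwo i (proj₁ tᵢ) j k i≢j (≢-sym k≢i) (≢-sym k≢j) (sharesAt tᵢ (inj₂ tⱼ)) (sharesAt tᵢ tₖ))

  traversed-only-by : ∀ {i j x y} → i ≢ j → Traverses i x y → Traverses j y x →
                      ∀ k → k ≢ i → trav k x y ≡ false
  traversed-only-by i≢j tᵢ tⱼ k k≢i = ¬T⇒≡false λ t →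
    case on-at-most-two i≢j tᵢ tⱼ (inj₁ (trav⁻ t)) of λ where
      (inj₁ k≡i)  → k≢i k≡i
      (inj₂ refl) → ¬traverses-both-ways (trav⁻ t) tⱼ

  record EdgeBetween (i j : Fin n) (b w : Fin V) : Set where
    field
      distinct         : i ≢ j
      black-white      : isBW b w ≡ true
      i-traverses      : trav i b w ≡ true
      j-traverses      : trav j w b ≡ true
      only-i-traverses : ∀ k → k ≢ i → trav k b w ≡ false
      only-j-traverses : ∀ k → k ≢ j → trav k w b ≡ false

  edgeBetween : ∀ {i j b w} → i ≢ j → isBW b w ≡ true → Traverses i b w → Traverses j w b →
                EdgeBetween i j b w
  edgeBetween i≢j bw tᵢ tⱼ = record
    { distinct         = i≢j
    ; black-white      = bw
    ; i-traverses      = trav⁺ tᵢ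
    ; j-traverses      = trav⁺ tⱼ
    ; only-i-traverses = traversed-only-by i≢j tᵢ tⱼ
    ; only-j-traverses = traversed-only-by (≢-sym i≢j) tⱼ tᵢ
    }

  module _ {i j b w} (E : EdgeBetween i j b w) where
    open EdgeBetween E

    inTile≡ : ∀ k → inTile k b w ≡ trav k b w ∨ trav k w b
    inTile≡ k = cong (_∧ (trav k b w ∨ trav k w b)) black-white

    inTileᵢ : inTile i b w ≡ true
    inTileᵢ = trans (inTile≡ i) (cong (_∨ trav i w b) i-traverses)

    inTileⱼ : inTile j b w ≡ true
    inTileⱼ = trans (inTile≡ j) (trans (cong (trav j b w ∨_) j-traverses) (∨-zeroʳ _))

    inTile-off : ∀ k → k ≢ i → k ≢ j → inTile k b w ≡ false
    inTile-off k k≢i k≢j = trans (inTile≡ k) (cong₂ _∨_ (only-i-traverses k k≢i) (only-j-traverses k k≢j))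

    δ≡ : ∀ k → δ k b w ≡ ind (trav k w b) - ind (trav k b w)
    δ≡ k = cong (λ c → ind (c ∧ trav k w b) - ind (c ∧ trav k b w)) black-white

    ∑flips≡ : ∀ (e : Fin n → ℕ) → ∑[ k < n ] (+ e k *ℤ δ k b w) ≡ + e j - + e i
    ∑flips≡ e = begin
      ∑[ k < n ] (+ e k *ℤ δ k b w)         ≡⟨ ℤΣ.sum-pair _ distinct off ⟩
      + e i *ℤ δ i b w +ℤ + e j *ℤ δ j b w  ≡⟨ cong₂ (λ u v → + e i *ℤ u +ℤ + e j *ℤ v) δᵢ δⱼ ⟩
      + e i *ℤ - 1ℤ +ℤ + e j *ℤ 1ℤ          ≡⟨ -x+y (+ e i) (+ e j) ⟩
      + e j - + e i                         ∎
      where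
      open ≡-Reasoning
      δᵢ : δ i b w ≡ - 1ℤ
      δᵢ = trans (δ≡ i) (cong₂ (λ u v → ind u - ind v) (only-j-traverses i distinct) i-traverses)
      δⱼ : δ j b w ≡ 1ℤ
      δⱼ = trans (δ≡ j) (cong₂ (λ u v → ind u - ind v) j-traverses (only-i-traverses j (≢-sym distinct)))
      off : ∀ k → k ≢ i → k ≢ j → + e k *ℤ δ k b w ≡ 0ℤ
      off k k≢i k≢j =
        trans (cong (+ e k *ℤ_) (trans (δ≡ k) (cong₂ (λ u v → ind u - ind v)
                                                     (only-j-traverses k k≢j) (only-i-traverses k k≢i))))
              (ℤ.*-zeroʳ (+ e k))
      -x+y : ∀ x y → x *ℤ - 1ℤ +ℤ y *ℤ 1ℤ ≡ y - x
      -x+y = solve-∀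

    bdryBW≡ : ∀ (H : Fin n → Bool) → bdryBW H b w ≡ H i ∧ not (H j)
    bdryBW≡ H = begin
      bdryBW H b w
        ≡⟨ cong₂ (λ s t → (s ≡ᵇ 1) ∧ (t ≡ᵇ 1)) on-edge traversed-b→w ⟩
      ((indℕ (H i) +ℕ indℕ (H j)) ≡ᵇ 1) ∧ (indℕ (H i) ≡ᵇ 1)
        ≡⟨ exactlyOne∧first≡first∧¬second (H i) (H j) ⟩
      H i ∧ not (H j)
        ∎
      where
      open ≡-Reasoning
      H∧true : ∀ {k c} → c ≡ true → H k ∧ c ≡ H k
      H∧true {k} refl = ∧-identityʳ (H k)
      on-edge : countFin (λ k → H k ∧ inTile k b w) ≡ indℕ (H i) +ℕ indℕ (H j)
      on-edge =
        trans (countFin-pair _ distinct (λ k k≢i k≢j →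
                 trans (cong (H k ∧_) (inTile-off k k≢i k≢j)) (∧-zeroʳ (H k))))
              (cong₂ (λ u v → indℕ u +ℕ indℕ v) (H∧true inTileᵢ) (H∧true inTileⱼ))
      traversed-b→w : countFin (λ k → H k ∧ bwIn k b w) ≡ indℕ (H i)
      traversed-b→w =
        trans (countFin-single _ i (λ k k≢i →
                 trans (cong (H k ∧_) (trans (bwIn≡ k) (only-i-traverses k k≢i))) (∧-zeroʳ (H k))))
              (cong indℕ (H∧true (trans (bwIn≡ i) i-traverses)))
        where
        bwIn≡ : ∀ k → bwIn k b w ≡ trav k b w
        bwIn≡ k = cong (_∧ trav k b w) black-white

    weight≡nIJ : ∀ d e → (∀ k → d k ≤ 2) → weight d e b w ≡ nIJ d e i j
    weight≡nIJ d e d≤2 = begin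
      weight d e b w                                       ≡⟨ weight≡init+∑ d e b w ⟩
      initWeight d b w +ℤ ∑[ k < n ] (+ e k *ℤ δ k b w)   ≡⟨ cong₂ _+ℤ_ initWeight≡ (∑flips≡ e) ⟩
      nIJ d e i j                                          ∎
      where
      open ≡-Reasoning
      initWeight≡ : initWeight d b w ≡ (+ d i - + d j) ⊔ + 0
      initWeight≡ = trans (cong₂ (λ u v → ind u +ℤ ind v) (bdryBW≡ (λ k → 1 ≤ᵇ d k)) (bdryBW≡ (λ k → d k ≡ᵇ 2)))
                          (levels≡positivePart (d≤2 i) (d≤2 j))

    edgeBetween→Interior : Interior b w
    edgeBetween→Interior = i , j , distinct , from T-≡ inTileᵢ , from T-≡ inTileⱼ

  arrow-irreflexive : ∀ {i j} → Arrow Q i j → i ≢ j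
  arrow-irreflexive a refl = arr-asym _ _ a a

  arrow-source-black : ∀ {i j x y} → Arrow Q i j → Traverses i x y → Traverses j y x → black x ≡ true
  arrow-source-black a tᵢ@(p , p₀ , _) tⱼ =
    trans (cong black (sym p₀)) (arrowBW _ _ a p (sharesAt tᵢ (inj₂ tⱼ)))

  arrow-oriented : ∀ {i j b w} → i ≢ j → isBW b w ≡ true → Traverses i b w → Traverses j w b →
                   Arrow Q i j
  arrow-oriented {i} {j} i≢j bw tᵢ tⱼ with arr-tot i j (share→adj i j i≢j (_ , sharesAt tᵢ (inj₂ tⱼ)))
  ... | inj₁ i→j = i→j
  ... | inj₂ j→i = case trans (sym (arrow-source-black j→i tⱼ tᵢ)) (∧-not≡true⇒≡false bw) of λ ()

  arrow→edgeBetween : ∀ {i j} → Arrow Q i j → ∃₂ λ b w → EdgeBetween i j b w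
  arrow→edgeBetween {i} {j} a with adj→share i j (arr-adj i j a)
  ... | p , q , inj₁ same-way =
    ⊥-elim (¬traverses-same-way (arrow-irreflexive a) (p , refl , refl) (q , same-way))
  ... | p , q , inj₂ opposite =
    cyc i p , cyc i (next p) , edgeBetween (arrow-irreflexive a) black-white tᵢ tⱼ
    where
    tᵢ : Traverses i (cyc i p) (cyc i (next p))
    tᵢ = p , refl , refl
    tⱼ : Traverses j (cyc i (next p)) (cyc i p)
    tⱼ = q , opposite
    black-b : black (cyc i p) ≡ true
    black-b = arrow-source-black a tᵢ tⱼ
    black-white : isBW (cyc i p) (cyc i (next p)) ≡ true
    black-white = cong₂ _∧_ black-b (trans (sym (¬-not (bipartite i p))) black-b)

  inTile⁻ : ∀ {k b w} → T (inTile k b w) → T (isBW b w) × (Traverses k b w ⊎ Traverses k w b)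
  inTile⁻ {k} {b} {w} t with to (T-∧ {isBW b w}) t
  ... | bw , t′ with to (T-∨ {trav k b w}) t′
  ...   | inj₁ t-bw = bw , inj₁ (trav⁻ t-bw)
  ...   | inj₂ t-wb = bw , inj₂ (trav⁻ t-wb)

  oriented-edge : ∀ {i j b w} → i ≢ j → T (isBW b w) → Traverses i b w → Traverses j w b →
                  Arrow Q i j × EdgeBetween i j b w
  oriented-edge i≢j bw tᵢ tⱼ = arrow-oriented i≢j (to T-≡ bw) tᵢ tⱼ , edgeBetween i≢j (to T-≡ bw) tᵢ tⱼ

  interior→arrow : ∀ {b w} → Interior b w → ∃₂ λ i j → Arrow Q i j × EdgeBetween i j b w
  interior→arrow (i , j , i≢j , onᵢ , onⱼ) with inTile⁻ onᵢ | inTile⁻ onⱼ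
  ... | bw , inj₁ tᵢ | _ , inj₂ tⱼ = i , j , oriented-edge i≢j bw tᵢ tⱼ
  ... | bw , inj₂ tᵢ | _ , inj₁ tⱼ = j , i , oriented-edge (≢-sym i≢j) bw tⱼ tᵢ
  ... | _  , inj₁ tᵢ | _ , inj₁ tⱼ = ⊥-elim (¬traverses-same-way i≢j tᵢ tⱼ)
  ... | _  , inj₂ tᵢ | _ , inj₂ tⱼ = ⊥-elim (¬traverses-same-way i≢j tᵢ tⱼ)

corollary4p1 : (n : ℕ) → 4 ≤ n → (Q : Orientation n) → (G : BaseGraph n Q) →
    (d : Fin n → ℕ) → PosRoot n d → (e : Fin n → ℕ) → (∀ k → e k ≤ d k) →
    ((∀ i j → Arrow Q i j → + 0 ≤ℤ nIJ d e i j) ⇔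
       (∀ b w → BaseGraph.Interior G b w → + 0 ≤ℤ BaseGraph.weight G d e b w))
    × ((∀ i j → Arrow Q i j → Acceptable d e i j) ⇔
       (∀ b w → BaseGraph.Interior G b w → + 0 ≤ℤ BaseGraph.weight G d e b w))
corollary4p1 n _ Q G d root e _ = arrows⇔edges , ⇔-trans acceptable⇔nonneg arrows⇔edges
  where
  open TileGraph G
  arrows⇔edges : (∀ i j → Arrow Q i j → + 0 ≤ℤ nIJ d e i j) ⇔
                 (∀ b w → BaseGraph.Interior G b w → + 0 ≤ℤ BaseGraph.weight G d e b w)
  arrows⇔edges = mk⇔
    (λ nonneg b w interior → let i , j , i→j , E = interior→arrow interior in
       subst (+ 0 ≤ℤ_) (sym (weight≡nIJ E d e (posRoot-≤2 root))) (nonneg i j i→j))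
    (λ nonneg i j i→j → let b , w , E = arrow→edgeBetween i→j in
       subst (+ 0 ≤ℤ_) (weight≡nIJ E d e (posRoot-≤2 root)) (nonneg b w (edgeBetween→Interior E)))
  acceptable⇔nonneg : (∀ i j → Arrow Q i j → Acceptable d e i j) ⇔
                      (∀ i j → Arrow Q i j → + 0 ≤ℤ nIJ d e i j)
  acceptable⇔nonneg = mk⇔
    (λ acc i j i→j → to (Acceptable⇔0≤nIJ d e i j) (acc i j i→j))
    (λ nonneg i j i→j → from (Acceptable⇔0≤nIJ d e i j) (nonneg i j i→j))
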